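{- For $e\ge 2$, the group $\mathrm{ASL}_2(2^e)$ of affine transformations of $X=\mathbb{F}_{2^e}^2$ does not have the strict-EKR property.
   Context: $\mathrm{ASL}_2(q)$ is the group of permutations of $\mathbb{F}_q^2$ of the form $x\mapsto Ax+v$ with $A\in\mathrm{SL}_2(q)$, $v\in\mathbb{F}_q^2$. For a permutation group $G$ on $X$, two elements $g,h$ intersect if $i^g=i^h$ for some $i\in X$; a maximum intersecting set is a set of pairwise intersecting elements of largest possible size. The canonical intersecting sets are $S_{i,j}=\{g\in G: i^g=j\}$, $i,j\in X$. $G$ has the strict-EKR property if the canonical intersecting sets are exactly the maximum intersecting sets (i.e., they are maximum and there are no others). -}

module Defs where

open import Level using (0ℓ)
open import Data.Nat using (ℕ; _≤_)
open import Data.Fin using (Fin)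
open import Data.Product using (_×_; _,_; ∃; Σ)
open import Data.List using (List; length)
open import Data.List.Membership.Propositional using (_∈_)
open import Data.List.Relation.Unary.All using (All)
open import Data.List.Relation.Unary.Unique.Propositional using (Unique)
open import Relation.Binary.PropositionalEquality using (_≡_)
open import Relation.Nullary using (¬_)
open import Algebra.Core using (Op₁; Op₂)
open import Algebra.Structures using (IsCommutativeRing)

-- A field whose underlying set is Fin q (so it has exactly q elements),
-- with propositional equality.  Every finite field of order q is
-- isomorphic to such a structure.
record FieldOn (q : ℕ) : Set where
  infixl 6 _+_
  infixl 7 _*_
  field
    _+_ _*_ : Op₂ (Fin q)
    -_      : Op₁ (Fin q)
    0# 1#   : Fin q
    isCommutativeRing : IsCommutativeRing _≡_ _+_ _*_ -_ 0# 1#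
    0≢1     : ¬ (0# ≡ 1#)
    inverse : ∀ x → ¬ (x ≡ 0#) → ∃ λ y → x * y ≡ 1#

module ASL2 {q : ℕ} (F : FieldOn q) where
  open FieldOn F

  Point : Set
  Point = Fin q × Fin q

  -- affine data x ↦ A x + v with A = [[a , b] , [c , d]], v = (v₁ , v₂)
  record Affine : Set where
    constructor affine
    field
      a b c d v₁ v₂ : Fin q

  open Affine public

  InASL : Affine → Set
  InASL g = a g * d g + - (b g * c g) ≡ 1#

  act : Point → Affine → Point
  act (x , y) g = (a g * x + b g * y + v₁ g , c g * x + d g * y + v₂ g)

  Intersect : Affine → Affine → Set
  Intersect g h = ∃ λ (i : Point) → act i g ≡ act i h

  IsIntersecting : List Affine → Set
  IsIntersecting S =
    All InASL S × Unique S × (∀ {g h} → g ∈ S → h ∈ S → Intersect g h)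

  IsMaximumIntersecting : List Affine → Set
  IsMaximumIntersecting S =
    IsIntersecting S × (∀ T → IsIntersecting T → length T ≤ length S)

  IsCanonical : Point → Point → List Affine → Set
  IsCanonical i j S =
    Unique S × (∀ g → (g ∈ S → InASL g × act i g ≡ j) × (InASL g × act i g ≡ j → g ∈ S))

  StrictEKR : Set
  StrictEKR =
    (∀ i j S → IsCanonical i j S → IsMaximumIntersecting S)
    × (∀ S → IsMaximumIntersecting S → Σ Point λ i → Σ Point λ j → IsCanonical i j S)

module Submission where

-- Over a field of characteristic two, squaring is an injective ring
-- endomorphism, and every m = (a b ; c d) ∈ SL₂(q) yields the affine map
--   g_m : x ↦ m^[2] x + (a b , c d),      m^[2] = (a² b² ; c² d²),
-- which lies in ASL₂(q) because det m^[2] = (det m)².  The family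
-- T = { g_m : m ∈ SL₂(q) } has exactly as many elements as the stabiliser
-- S_{0,0} = SL₂(q).  Two members g_m, g_m′ agree at p iff p solves the 2 × 2
-- "difference system" with matrix (m + m′)^[2]; it is solvable either by
-- Cramer's rule or, when m + m′ is singular, because det m = det m′ = 1 makes
-- its equations compatible.  So T is intersecting, hence maximum if strict-EKR
-- held; but T is not canonical: it contains the identity, so it would be a
-- stabiliser S_{i,i}, and then the transvections fixing i would be twisted,
-- forcing s = s² for every s ∈ F_q, which fails as q ≥ 4.

open import Defs
open import Level using (0ℓ)
open import Data.Nat using (ℕ; zero; suc; _≤_; _^_; z≤n; s≤s)
open import Data.Nat.Properties using (suc-injective; ≤-trans; ≤-reflexive; ^-monoʳ-≤)
import Data.Nat.Properties as Nat
open import Data.Nat.Divisibility using (_∣_; divides; ∣-refl; ∣m∣n⇒∣m+n; ∣m+n∣m⇒∣n; ∣1⇒≡1; m∣m*n)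
open import Data.Fin using (Fin; zero; punchIn; punchOut)
open import Data.Fin.Properties using (_≟_; punchInᵢ≢i; punchIn-injective; punchIn-punchOut)
open import Data.Product using (_×_; _,_; ∃; proj₁; proj₂)
open import Data.Sum using (_⊎_; inj₁; inj₂)
open import Data.List using (List; []; _∷_; length; map; filter; allFin; cartesianProduct)
open import Data.List.Properties using (filter-all; filter-accept; filter-reject; length-tabulate; length-map)
open import Data.List.Membership.Propositional using (_∈_)
open import Data.List.Membership.Propositional.Properties
  using (∈-filter⁺; ∈-filter⁻; ∈-allFin; ∈-map⁺; ∈-map⁻; ∈-cartesianProduct⁺)
open import Data.List.Relation.Unary.Any using (here; there)
open import Data.List.Relation.Unary.All as All using (All)
import Data.List.Relation.Unary.All.Properties as AllProperties
open import Data.List.Relation.Unary.AllPairs using (_∷_)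
open import Data.List.Relation.Unary.Unique.Propositional using (Unique)
import Data.List.Relation.Unary.Unique.Propositional.Properties as Unique
open import Algebra.Bundles using (CommutativeRing)
open import Relation.Nullary using (¬_; ¬?; Dec; yes; no; contradiction)
open import Relation.Binary.Definitions using (DecidableEquality)
open import Relation.Binary.PropositionalEquality

-- Counting modulo 2 with a fixed-point-free involution: a duplicate-free
-- list closed under such an involution splits into pairs {x , σ x}.
module Parity {A : Set} (_≟_ : DecidableEquality A) where

  remove : A → List A → List A
  remove y = filter (λ z → ¬? (z ≟ y))

  ∈-remove⁺ : ∀ {x y xs} → x ∈ xs → ¬ x ≡ y → x ∈ remove y xs
  ∈-remove⁺ {y = y} x∈xs x≢y = ∈-filter⁺ (λ z → ¬? (z ≟ y)) x∈xs x≢y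

  ∈-remove⁻ : ∀ {x y} xs → x ∈ remove y xs → x ∈ xs × ¬ x ≡ y
  ∈-remove⁻ {y = y} xs = ∈-filter⁻ (λ z → ¬? (z ≟ y)) {xs = xs}

  length-remove : ∀ {y} xs → Unique xs → y ∈ xs → length xs ≡ suc (length (remove y xs))
  length-remove {y} (y ∷ ys) (y∉ys ∷ _) (here refl) = cong (λ zs → suc (length zs)) (sym removed)
    where
    removed : remove y (y ∷ ys) ≡ ys
    removed = trans (filter-reject (λ z → ¬? (z ≟ y)) (λ y≢y → y≢y refl))
                    (filter-all (λ z → ¬? (z ≟ y)) (All.map (λ y≢z z≡y → y≢z (sym z≡y)) y∉ys))
  length-remove {y} (z ∷ ys) (z∉ys ∷ u) (there y∈ys) =
    trans (cong suc (length-remove ys u y∈ys)) (cong (λ zs → suc (length zs)) (sym kept))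
    where
    kept : remove y (z ∷ ys) ≡ z ∷ remove y ys
    kept = filter-accept (λ w → ¬? (w ≟ y)) (All.lookup z∉ys y∈ys)

  Closed FixedPointFree : (A → A) → List A → Set
  Closed σ xs = ∀ {x} → x ∈ xs → σ x ∈ xs
  FixedPointFree σ xs = ∀ {x} → x ∈ xs → ¬ σ x ≡ x

  module _ (σ : A → A) (involutive : ∀ x → σ (σ x) ≡ x) where

    σ-injective : ∀ {x y} → σ x ≡ σ y → x ≡ y
    σ-injective {x} {y} σx≡σy = trans (sym (involutive x)) (trans (cong σ σx≡σy) (involutive y))

    -- the orbits {x , σ x} partition xs, so its length n is even;
    -- the recursion removes one orbit at a time, decreasing n by two
    even-length : ∀ n xs → length xs ≡ n → Unique xs → Closed σ xs → FixedPointFree σ xs → 2 ∣ n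
    even-length zero [] _ _ _ _ = divides 0 refl
    even-length (suc zero) (x ∷ []) _ _ closed fpf with closed (here refl)
    ... | here σx≡x = contradiction σx≡x (fpf (here refl))
    even-length (suc (suc n)) (x ∷ ys) len (x∉ys ∷ u) closed fpf =
      ∣m∣n⇒∣m+n ∣-refl (even-length n zs length-zs (Unique.filter⁺ _ u) closed-zs fpf-zs)
      where
      σx∈ys : σ x ∈ ys
      σx∈ys with closed (here refl)
      ... | here σx≡x = contradiction σx≡x (fpf (here refl))
      ... | there σx∈ys = σx∈ys
      zs : List A
      zs = remove (σ x) ys
      length-zs : length zs ≡ n
      length-zs = suc-injective (suc-injective (trans (cong suc (sym (length-remove ys u σx∈ys))) len))
      closed-zs : Closed σ zs
      closed-zs {w} w∈zs with ∈-remove⁻ ys w∈zs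
      ... | w∈ys , w≢σx with closed (there w∈ys)
      ... | here σw≡x = contradiction (trans (sym (involutive w)) (cong σ σw≡x)) w≢σx
      ... | there σw∈ys = ∈-remove⁺ σw∈ys (λ σw≡σx → All.lookup x∉ys w∈ys (sym (σ-injective σw≡σx)))
      fpf-zs : FixedPointFree σ zs
      fpf-zs w∈zs = fpf (there (proj₁ (∈-remove⁻ ys w∈zs)))

module FieldFacts {q : ℕ} (F : FieldOn q) where

  open FieldOn F public using (_+_; _*_; -_; 0#; 1#; inverse)

  ring : CommutativeRing 0ℓ 0ℓ
  ring = record { isCommutativeRing = FieldOn.isCommutativeRing F }

  open CommutativeRing ring public
    using (+-comm; +-assoc; +-identityˡ; +-identityʳ; zeroˡ; zeroʳ; *-identityˡ; *-identityʳ; distribˡ; distribʳ; -‿inverseʳ)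
  open import Algebra.Properties.Ring (CommutativeRing.ring ring) public
    using (-‿involutive; -0#≈0#; +-inverseˡ-unique; +-cancelˡ)
  open import Algebra.Solver.Ring.NaturalCoefficients.Default (CommutativeRing.commutativeSemiring ring) public
    using (solve; _:+_; _:*_; _:=_)
  open ≡-Reasoning

  no-zero-divisors : ∀ {x y} → x * y ≡ 0# → ¬ x ≡ 0# → y ≡ 0#
  no-zero-divisors {x} {y} xy≡0 x≢0 with inverse x x≢0
  ... | x⁻¹ , xx⁻¹≡1 = begin
    y                 ≡⟨ sym (*-identityˡ y) ⟩
    1# * y            ≡⟨ cong (_* y) (sym xx⁻¹≡1) ⟩
    (x * x⁻¹) * y     ≡⟨ solve 3 (λ x x' y → (x :* x') :* y := x' :* (x :* y)) refl x x⁻¹ y ⟩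
    x⁻¹ * (x * y)     ≡⟨ cong (x⁻¹ *_) xy≡0 ⟩
    x⁻¹ * 0#          ≡⟨ zeroʳ x⁻¹ ⟩
    0#                ∎

  square-zero : ∀ x → x * x ≡ 0# → x ≡ 0#
  square-zero x xx≡0 with x ≟ 0#
  ... | yes x≡0 = x≡0
  ... | no x≢0 = no-zero-divisors xx≡0 x≢0

  vanish : ∀ x y → x * 0# + y * 0# ≡ 0#
  vanish x y = trans (cong₂ _+_ (zeroʳ x) (zeroʳ y)) (+-identityʳ 0#)

  Solves : (A B C D s₁ s₂ : Fin q) → Fin q × Fin q → Set
  Solves A B C D s₁ s₂ (p₁ , p₂) = A * p₁ + B * p₂ ≡ s₁ × C * p₁ + D * p₂ ≡ s₂

  -- the normaliser below knows no negation, so - y is written y * - 1#,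
  -- and terms cancel through this identity
  cancel-negation : ∀ x → x + x * - 1# ≡ 0#
  cancel-negation x = begin
    x + x * - 1#         ≡⟨ cong (_+ x * - 1#) (sym (*-identityʳ x)) ⟩
    x * 1# + x * - 1#    ≡⟨ sym (distribˡ x 1# (- 1#)) ⟩
    x * (1# + - 1#)      ≡⟨ cong (x *_) (-‿inverseʳ 1#) ⟩
    x * 0#               ≡⟨ zeroʳ x ⟩
    0#                   ∎

  cramer : ∀ A B C D s₁ s₂ → ¬ A * D ≡ B * C → ∃ (Solves A B C D s₁ s₂)
  cramer A B C D s₁ s₂ AD≢BC = solution (inverse Δ Δ≢0)
    where
    n : Fin q
    n = - 1#
    Δ : Fin q
    Δ = A * D + B * C * n
    Δ≢0 : ¬ Δ ≡ 0#
    Δ≢0 Δ≡0 = AD≢BC (begin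
      A * D                        ≡⟨ +-inverseˡ-unique (A * D) (B * C * n) Δ≡0 ⟩
      - (B * C * n)                ≡⟨ cong -_ (+-inverseˡ-unique (B * C * n) (B * C) (trans (+-comm _ _) (cancel-negation (B * C)))) ⟩
      - (- (B * C))                ≡⟨ -‿involutive (B * C) ⟩
      B * C                        ∎)
    solution : ∃ (λ Δ⁻¹ → Δ * Δ⁻¹ ≡ 1#) → ∃ (Solves A B C D s₁ s₂)
    solution (Δ⁻¹ , ΔΔ⁻¹≡1) = (Δ⁻¹ * (D * s₁ + B * s₂ * n) , Δ⁻¹ * (A * s₂ + C * s₁ * n)) , first , second
      where
      first : A * (Δ⁻¹ * (D * s₁ + B * s₂ * n)) + B * (Δ⁻¹ * (A * s₂ + C * s₁ * n)) ≡ s₁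
      first = begin
        A * (Δ⁻¹ * (D * s₁ + B * s₂ * n)) + B * (Δ⁻¹ * (A * s₂ + C * s₁ * n))
          ≡⟨ solve 8 (λ A B C D s₁ s₂ Δ⁻¹ n →
               A :* (Δ⁻¹ :* (D :* s₁ :+ B :* s₂ :* n)) :+ B :* (Δ⁻¹ :* (A :* s₂ :+ C :* s₁ :* n))
               := (A :* D :+ B :* C :* n) :* Δ⁻¹ :* s₁ :+ (Δ⁻¹ :* A :* B :* s₂ :+ Δ⁻¹ :* A :* B :* s₂ :* n))
               refl A B C D s₁ s₂ Δ⁻¹ n ⟩
        Δ * Δ⁻¹ * s₁ + (Δ⁻¹ * A * B * s₂ + Δ⁻¹ * A * B * s₂ * n)
          ≡⟨ cong₂ _+_ (cong (_* s₁) ΔΔ⁻¹≡1) (cancel-negation _) ⟩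
        1# * s₁ + 0#
          ≡⟨ trans (+-identityʳ _) (*-identityˡ s₁) ⟩
        s₁ ∎
      second : C * (Δ⁻¹ * (D * s₁ + B * s₂ * n)) + D * (Δ⁻¹ * (A * s₂ + C * s₁ * n)) ≡ s₂
      second = begin
        C * (Δ⁻¹ * (D * s₁ + B * s₂ * n)) + D * (Δ⁻¹ * (A * s₂ + C * s₁ * n))
          ≡⟨ solve 8 (λ A B C D s₁ s₂ Δ⁻¹ n →
               C :* (Δ⁻¹ :* (D :* s₁ :+ B :* s₂ :* n)) :+ D :* (Δ⁻¹ :* (A :* s₂ :+ C :* s₁ :* n))
               := (A :* D :+ B :* C :* n) :* Δ⁻¹ :* s₂ :+ (Δ⁻¹ :* C :* D :* s₁ :+ Δ⁻¹ :* C :* D :* s₁ :* n))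
               refl A B C D s₁ s₂ Δ⁻¹ n ⟩
        Δ * Δ⁻¹ * s₂ + (Δ⁻¹ * C * D * s₁ + Δ⁻¹ * C * D * s₁ * n)
          ≡⟨ cong₂ _+_ (cong (_* s₂) ΔΔ⁻¹≡1) (cancel-negation _) ⟩
        1# * s₂ + 0#
          ≡⟨ trans (+-identityʳ _) (*-identityˡ s₂) ⟩
        s₂ ∎

  pivot : ∀ A B C D s₁ s₂ → ¬ A ≡ 0# → C * s₁ ≡ A * s₂ → ∃ (Solves A B C D s₁ s₂)
  pivot A B C D s₁ s₂ A≢0 compatible with inverse A A≢0
  ... | A⁻¹ , AA⁻¹≡1 = (A⁻¹ * s₁ , 0#) , first , second
    where
    unscale : ∀ s → A * (A⁻¹ * s) ≡ s
    unscale s = begin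
      A * (A⁻¹ * s)    ≡⟨ solve 3 (λ A A⁻¹ s → A :* (A⁻¹ :* s) := (A :* A⁻¹) :* s) refl A A⁻¹ s ⟩
      (A * A⁻¹) * s    ≡⟨ cong (_* s) AA⁻¹≡1 ⟩
      1# * s           ≡⟨ *-identityˡ s ⟩
      s                ∎
    first : A * (A⁻¹ * s₁) + B * 0# ≡ s₁
    first = trans (cong (A * (A⁻¹ * s₁) +_) (zeroʳ B)) (trans (+-identityʳ _) (unscale s₁))
    second : C * (A⁻¹ * s₁) + D * 0# ≡ s₂
    second = begin
      C * (A⁻¹ * s₁) + D * 0#  ≡⟨ trans (cong (C * (A⁻¹ * s₁) +_) (zeroʳ D)) (+-identityʳ _) ⟩
      C * (A⁻¹ * s₁)           ≡⟨ solve 3 (λ A⁻¹ C s₁ → C :* (A⁻¹ :* s₁) := A⁻¹ :* (C :* s₁)) refl A⁻¹ C s₁ ⟩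
      A⁻¹ * (C * s₁)           ≡⟨ cong (A⁻¹ *_) compatible ⟩
      A⁻¹ * (A * s₂)           ≡⟨ solve 3 (λ A A⁻¹ s₂ → A⁻¹ :* (A :* s₂) := A :* (A⁻¹ :* s₂)) refl A A⁻¹ s₂ ⟩
      A * (A⁻¹ * s₂)           ≡⟨ unscale s₂ ⟩
      s₂                       ∎

  swap-unknowns : ∀ {A B C D s₁ s₂} → ∃ (Solves B A D C s₁ s₂) → ∃ (Solves A B C D s₁ s₂)
  swap-unknowns {A} {B} {C} {D} ((p₂ , p₁) , first , second) =
    (p₁ , p₂) , trans (+-comm (A * p₁) (B * p₂)) first , trans (+-comm (C * p₁) (D * p₂)) second

  swap-equations : ∀ {A B C D s₁ s₂} → ∃ (Solves C D A B s₂ s₁) → ∃ (Solves A B C D s₁ s₂)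
  swap-equations (p , second , first) = p , first , second

  nonzero-row : ∀ A B C D s₁ s₂ → ¬ A ≡ 0# ⊎ ¬ B ≡ 0# →
                C * s₁ ≡ A * s₂ → D * s₁ ≡ B * s₂ → ∃ (Solves A B C D s₁ s₂)
  nonzero-row A B C D s₁ s₂ (inj₁ A≢0) compatible _ = pivot A B C D s₁ s₂ A≢0 compatible
  nonzero-row A B C D s₁ s₂ (inj₂ B≢0) _ compatible = swap-unknowns (pivot B A D C s₁ s₂ B≢0 compatible)

  singular : ∀ A B C D s₁ s₂ → C * s₁ ≡ A * s₂ → D * s₁ ≡ B * s₂ →
             (A ≡ 0# → B ≡ 0# → s₁ ≡ 0#) → (C ≡ 0# → D ≡ 0# → s₂ ≡ 0#) → ∃ (Solves A B C D s₁ s₂)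
  singular A B C D s₁ s₂ compat₁ compat₂ zero-row₁ zero-row₂ with A ≟ 0# | B ≟ 0#
  ... | no A≢0 | _      = nonzero-row A B C D s₁ s₂ (inj₁ A≢0) compat₁ compat₂
  ... | yes _  | no B≢0 = nonzero-row A B C D s₁ s₂ (inj₂ B≢0) compat₁ compat₂
  ... | yes A≡0 | yes B≡0 with C ≟ 0# | D ≟ 0#
  ...   | no C≢0 | _      = swap-equations (nonzero-row C D A B s₂ s₁ (inj₁ C≢0) (sym compat₁) (sym compat₂))
  ...   | yes _  | no D≢0 = swap-equations (nonzero-row C D A B s₂ s₁ (inj₂ D≢0) (sym compat₁) (sym compat₂))
  ...   | yes C≡0 | yes D≡0 =
    (0# , 0#) , trans (vanish A B) (sym (zero-row₁ A≡0 B≡0)) , trans (vanish C D) (sym (zero-row₂ C≡0 D≡0))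

  doubling : ∀ x → (1# + 1#) * x ≡ x + x
  doubling x = trans (distribʳ x 1# 1#) (cong₂ _+_ (*-identityˡ x) (*-identityˡ x))

  HasCharacteristicTwo : Set
  HasCharacteristicTwo = 1# + 1# ≡ 0#

  -- a field with an even number of elements has characteristic two:
  -- otherwise x ↦ - x pairs off the nonzero elements, leaving q odd
  even-order⇒char2 : 2 ∣ q → HasCharacteristicTwo
  even-order⇒char2 2∣q with (1# + 1#) ≟ 0#
  ... | yes 1+1≡0 = 1+1≡0
  ... | no 1+1≢0 = contradiction (∣1⇒≡1 2∣1) (λ ())
    where
    open Parity _≟_
    nonzero : List (Fin q)
    nonzero = remove 0# (allFin q)
    q≡1+n : q ≡ suc (length nonzero)
    q≡1+n = trans (sym (length-tabulate (λ x → x))) (length-remove (allFin q) (Unique.allFin⁺ q) (∈-allFin 0#))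
    closed : Closed -_ nonzero
    closed {x} x∈ = ∈-remove⁺ (∈-allFin (- x)) (λ -x≡0 → proj₂ (∈-remove⁻ (allFin q) x∈) (begin
      x          ≡⟨ sym (-‿involutive x) ⟩
      - (- x)    ≡⟨ cong -_ -x≡0 ⟩
      - 0#       ≡⟨ -0#≈0# ⟩
      0#         ∎))
    fixed-point-free : FixedPointFree -_ nonzero
    fixed-point-free {x} x∈ -x≡x = proj₂ (∈-remove⁻ (allFin q) x∈) (no-zero-divisors 2x≡0 1+1≢0)
      where
      2x≡0 : (1# + 1#) * x ≡ 0#
      2x≡0 = trans (doubling x) (trans (cong (x +_) (sym -x≡x)) (-‿inverseʳ x))
    2∣n : 2 ∣ length nonzero
    2∣n = even-length -_ -‿involutive (length nonzero) nonzero refl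
            (Unique.filter⁺ _ (Unique.allFin⁺ q)) closed fixed-point-free
    2∣1 : 2 ∣ 1
    2∣1 = ∣m+n∣m⇒∣n (subst (2 ∣_) (trans q≡1+n (Nat.+-comm 1 (length nonzero))) 2∣q) 2∣n

-- An intersecting set as large as a canonical one but not canonical itself
-- violates strict-EKR: the canonical set is maximum, hence so is the other.
module _ {q : ℕ} (F : FieldOn q) where
  open ASL2 F using (IsIntersecting; IsCanonical; StrictEKR)

  strictEKR-fails : ∀ i j S T → IsCanonical i j S → IsIntersecting T → length T ≡ length S →
                    (∀ i′ j′ → ¬ IsCanonical i′ j′ T) → ¬ StrictEKR
  strictEKR-fails i j S T S-canonical T-intersecting |T|≡|S| T-not-canonical (canonical⇒maximum , maximum⇒canonical)
    with maximum⇒canonical T (T-intersecting , λ U U-intersecting →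
           ≤-trans (proj₂ (canonical⇒maximum i j S S-canonical) U U-intersecting) (≤-reflexive (sym |T|≡|S|)))
  ... | i′ , j′ , T-canonical = T-not-canonical i′ j′ T-canonical

module CharacteristicTwo {q : ℕ} (F : FieldOn q) (char2 : FieldFacts.HasCharacteristicTwo F) where
  open FieldFacts F
  open ≡-Reasoning

  self-inverse : ∀ x → x + x ≡ 0#
  self-inverse x = trans (sym (doubling x)) (trans (cong (_* x) char2) (zeroˡ x))

  drop-double : ∀ x u → x + (u + u) ≡ x
  drop-double x u = trans (cong (x +_) (self-inverse u)) (+-identityʳ x)

  negation-trivial : ∀ x → - x ≡ x
  negation-trivial x = sym (+-inverseˡ-unique x x (self-inverse x))

  sum-zero : ∀ {x y} → x + y ≡ 0# → x ≡ y
  sum-zero {x} {y} x+y≡0 = trans (+-inverseˡ-unique x y x+y≡0) (negation-trivial y)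

  -- squaring is injective: (x + y)² = x² + y², and a field has no nilpotents
  square-injective : ∀ {x y} → x * x ≡ y * y → x ≡ y
  square-injective {x} {y} xx≡yy = sum-zero (square-zero (x + y) (begin
    (x + y) * (x + y)                  ≡⟨ solve 2 (λ x y → (x :+ y) :* (x :+ y) := x :* x :+ y :* y :+ (x :* y :+ x :* y)) refl x y ⟩
    x * x + y * y + (x * y + x * y)    ≡⟨ drop-double _ (x * y) ⟩
    x * x + y * y                      ≡⟨ cong (_+ y * y) xx≡yy ⟩
    y * y + y * y                      ≡⟨ self-inverse (y * y) ⟩
    0#                                 ∎))

module Matrices {q : ℕ} (F : FieldOn q) where
  open FieldFacts F
  open ASL2 F using (Point; Affine; affine; InASL; act; IsCanonical)

  -- a 2 × 2 matrix (a b ; c d) stored as (a , b , c , d)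
  Matrix : Set
  Matrix = Fin q × Fin q × Fin q × Fin q

  matrices : List Matrix
  matrices = cartesianProduct (allFin q) (cartesianProduct (allFin q) (cartesianProduct (allFin q) (allFin q)))

  ∈-matrices : ∀ m → m ∈ matrices
  ∈-matrices (a , b , c , d) =
    ∈-cartesianProduct⁺ (∈-allFin a) (∈-cartesianProduct⁺ (∈-allFin b) (∈-cartesianProduct⁺ (∈-allFin c) (∈-allFin d)))

  matrices-unique : Unique matrices
  matrices-unique = Unique.cartesianProduct⁺ (Unique.allFin⁺ q)
    (Unique.cartesianProduct⁺ (Unique.allFin⁺ q) (Unique.cartesianProduct⁺ (Unique.allFin⁺ q) (Unique.allFin⁺ q)))

  IsSL : Matrix → Set
  IsSL (a , b , c , d) = a * d + - (b * c) ≡ 1#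

  sl? : ∀ m → Dec (IsSL m)
  sl? (a , b , c , d) = a * d + - (b * c) ≟ 1#

  sl2 : List Matrix
  sl2 = filter sl? matrices

  ∈-sl2⁺ : ∀ {m} → IsSL m → m ∈ sl2
  ∈-sl2⁺ {m} m-sl = ∈-filter⁺ sl? (∈-matrices m) m-sl

  ∈-sl2⁻ : ∀ {m} → m ∈ sl2 → IsSL m
  ∈-sl2⁻ m∈sl2 = proj₂ (∈-filter⁻ sl? {xs = matrices} m∈sl2)

  sl2-unique : Unique sl2
  sl2-unique = Unique.filter⁺ sl? matrices-unique

  linear : Matrix → Affine
  linear (a , b , c , d) = affine a b c d 0# 0#

  linear-injective : ∀ {m m′} → linear m ≡ linear m′ → m ≡ m′
  linear-injective refl = refl

  origin : Point
  origin = (0# , 0#)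

  act-origin : ∀ a b c d v₁ v₂ → act origin (affine a b c d v₁ v₂) ≡ (v₁ , v₂)
  act-origin a b c d v₁ v₂ = cong₂ _,_ (translation a b v₁) (translation c d v₂)
    where
    translation : ∀ x y v → x * 0# + y * 0# + v ≡ v
    translation x y v = trans (cong (_+ v) (vanish x y)) (+-identityˡ v)

  stabiliser-canonical : IsCanonical origin origin (map linear sl2)
  stabiliser-canonical = Unique.map⁺ linear-injective sl2-unique , λ g → members g , members⁻¹ g
    where
    members : ∀ g → g ∈ map linear sl2 → InASL g × act origin g ≡ origin
    members g g∈ with ∈-map⁻ linear g∈
    ... | (a , b , c , d) , m∈sl2 , refl = ∈-sl2⁻ m∈sl2 , act-origin a b c d 0# 0#
    members⁻¹ : ∀ g → InASL g × act origin g ≡ origin → g ∈ map linear sl2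
    members⁻¹ (affine a b c d v₁ v₂) (g-sl , g-fixes) with trans (sym (act-origin a b c d v₁ v₂)) g-fixes
    ... | refl = ∈-map⁺ linear (∈-sl2⁺ g-sl)

module TwistedFamily {q : ℕ} (F : FieldOn q) (char2 : FieldFacts.HasCharacteristicTwo F) where
  open FieldFacts F
  open CharacteristicTwo F char2
  open Matrices F
  open ASL2 F using (Affine; affine; module Affine; InASL; act; Intersect; IsIntersecting; IsCanonical; StrictEKR)
  open ≡-Reasoning

  twisted : Matrix → Affine
  twisted (a , b , c , d) = affine (a * a) (b * b) (c * c) (d * d) (a * b) (c * d)

  sl-det : ∀ {a b c d} → IsSL (a , b , c , d) → a * d + b * c ≡ 1#
  sl-det {a} {b} {c} {d} det = trans (cong (a * d +_) (sym (negation-trivial (b * c)))) det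

  -- det m^[2] = (det m)²
  twisted-sl : ∀ {m} → IsSL m → InASL (twisted m)
  twisted-sl {a , b , c , d} det = begin
    a * a * (d * d) + - (b * b * (c * c))
      ≡⟨ cong (a * a * (d * d) +_) (negation-trivial _) ⟩
    a * a * (d * d) + b * b * (c * c)
      ≡⟨ sym (drop-double _ (a * d * (b * c))) ⟩
    a * a * (d * d) + b * b * (c * c) + (a * d * (b * c) + a * d * (b * c))
      ≡⟨ solve 4 (λ a b c d → a :* a :* (d :* d) :+ b :* b :* (c :* c) :+ (a :* d :* (b :* c) :+ a :* d :* (b :* c))
                            := (a :* d :+ b :* c) :* (a :* d :+ b :* c)) refl a b c d ⟩
    (a * d + b * c) * (a * d + b * c)
      ≡⟨ cong₂ _*_ (sl-det det) (sl-det det) ⟩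
    1# * 1#
      ≡⟨ *-identityʳ 1# ⟩
    1# ∎

  twisted-injective : ∀ {m m′} → twisted m ≡ twisted m′ → m ≡ m′
  twisted-injective eq
    with square-injective (cong Affine.a eq) | square-injective (cong Affine.b eq)
       | square-injective (cong Affine.c eq) | square-injective (cong Affine.d eq)
  ... | refl | refl | refl | refl = refl

  -- entrywise sum of matrices; in characteristic two it is also their difference
  _⊕_ : Matrix → Matrix → Matrix
  (a , b , c , d) ⊕ (α , β , γ , δ) = (a + α , b + β , c + γ , d + δ)

  -- m′ = m ⊕ (m ⊕ m′), so every pair m, m′ has the form m, m ⊕ Δ
  ⊕-cancel : ∀ m m′ → m ⊕ (m ⊕ m′) ≡ m′
  ⊕-cancel (a , b , c , d) (a′ , b′ , c′ , d′) =
    cong₂ _,_ (cancel a a′) (cong₂ _,_ (cancel b b′) (cong₂ _,_ (cancel c c′) (cancel d d′)))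
    where
    cancel : ∀ x x′ → x + (x + x′) ≡ x′
    cancel x x′ = trans (sym (+-assoc x x x′)) (trans (cong (_+ x′) (self-inverse x)) (+-identityˡ x′))

  -- a b + (a + α) (b + β), the change of the translation entry of a row (a b)
  cross : Fin q → Fin q → Fin q → Fin q → Fin q
  cross a b α β = a * β + α * b + α * β

  row-agreement : ∀ a b α β p₁ p₂ → α * α * p₁ + β * β * p₂ ≡ cross a b α β →
                  (a + α) * (a + α) * p₁ + (b + β) * (b + β) * p₂ + (a + α) * (b + β) ≡ a * a * p₁ + b * b * p₂ + a * b
  row-agreement a b α β p₁ p₂ solves = begin
    (a + α) * (a + α) * p₁ + (b + β) * (b + β) * p₂ + (a + α) * (b + β)
      ≡⟨ solve 6 (λ a b α β p₁ p₂ →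
           (a :+ α) :* (a :+ α) :* p₁ :+ (b :+ β) :* (b :+ β) :* p₂ :+ (a :+ α) :* (b :+ β)
           := a :* a :* p₁ :+ b :* b :* p₂ :+ a :* b
              :+ (α :* α :* p₁ :+ β :* β :* p₂ :+ (a :* β :+ α :* b :+ α :* β))
              :+ (a :* α :* p₁ :+ b :* β :* p₂ :+ (a :* α :* p₁ :+ b :* β :* p₂))) refl a b α β p₁ p₂ ⟩
    a * a * p₁ + b * b * p₂ + a * b + (α * α * p₁ + β * β * p₂ + cross a b α β) + (E + E)
      ≡⟨ drop-double _ E ⟩
    a * a * p₁ + b * b * p₂ + a * b + (α * α * p₁ + β * β * p₂ + cross a b α β)
      ≡⟨ cong (λ s → a * a * p₁ + b * b * p₂ + a * b + (s + cross a b α β)) solves ⟩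
    a * a * p₁ + b * b * p₂ + a * b + (cross a b α β + cross a b α β)
      ≡⟨ drop-double _ (cross a b α β) ⟩
    a * a * p₁ + b * b * p₂ + a * b ∎
    where
    -- the cross terms of (a + α)², (b + β)², which occur twice
    E : Fin q
    E = a * α * p₁ + b * β * p₂

  -- the difference system of g_m and g_{m ⊕ Δ}, whose solutions are their common points
  DifferenceSystem : Matrix → Matrix → Fin q × Fin q → Set
  DifferenceSystem (a , b , c , d) (α , β , γ , δ) =
    Solves (α * α) (β * β) (γ * γ) (δ * δ) (cross a b α β) (cross c d γ δ)

  agreement : ∀ m Δ p → DifferenceSystem m Δ p → act p (twisted (m ⊕ Δ)) ≡ act p (twisted m)
  agreement (a , b , c , d) (α , β , γ , δ) (p₁ , p₂) (first , second) =
    cong₂ _,_ (row-agreement a b α β p₁ p₂ first) (row-agreement c d γ δ p₁ p₂ second)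

  -- If m and m ⊕ Δ have determinant one and Δ = (α β ; γ δ) is singular, the
  -- rows of the difference system are proportional to its right-hand side.
  -- Here K is the part of det (m ⊕ Δ) - det m that is linear in Δ.
  compatible₁ : ∀ a b c d α β γ δ → a * δ + α * d + b * γ + β * c ≡ 0# → α * δ + β * γ ≡ 0# →
                γ * γ * cross a b α β ≡ α * α * cross c d γ δ
  compatible₁ a b c d α β γ δ K≡0 D≡0 = sum-zero (begin
    γ * γ * cross a b α β + α * α * cross c d γ δ
      ≡⟨ sym (drop-double _ E) ⟩
    γ * γ * cross a b α β + α * α * cross c d γ δ + (E + E)
      ≡⟨ solve 8 (λ a b c d α β γ δ →
           γ :* γ :* (a :* β :+ α :* b :+ α :* β) :+ α :* α :* (c :* δ :+ γ :* d :+ γ :* δ)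
             :+ ((a :* α :* γ :* δ :+ c :* α :* β :* γ) :+ (a :* α :* γ :* δ :+ c :* α :* β :* γ))
           := α :* γ :* (a :* δ :+ α :* d :+ b :* γ :+ β :* c) :+ (a :* γ :+ α :* γ :+ α :* c) :* (α :* δ :+ β :* γ))
           refl a b c d α β γ δ ⟩
    α * γ * (a * δ + α * d + b * γ + β * c) + (a * γ + α * γ + α * c) * (α * δ + β * γ)
      ≡⟨ cong₂ (λ k D → α * γ * k + (a * γ + α * γ + α * c) * D) K≡0 D≡0 ⟩
    α * γ * 0# + (a * γ + α * γ + α * c) * 0#
      ≡⟨ vanish _ _ ⟩
    0# ∎)
    where
    -- the terms that the identity above needs twice, invisible in characteristic two
    E : Fin q
    E = a * α * γ * δ + c * α * β * γ

  compatible₂ : ∀ a b c d α β γ δ → a * δ + α * d + b * γ + β * c ≡ 0# → α * δ + β * γ ≡ 0# →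
                δ * δ * cross a b α β ≡ β * β * cross c d γ δ
  compatible₂ a b c d α β γ δ K≡0 D≡0 = sum-zero (begin
    δ * δ * cross a b α β + β * β * cross c d γ δ
      ≡⟨ sym (drop-double _ E) ⟩
    δ * δ * cross a b α β + β * β * cross c d γ δ + (E + E)
      ≡⟨ solve 8 (λ a b c d α β γ δ →
           δ :* δ :* (a :* β :+ α :* b :+ α :* β) :+ β :* β :* (c :* δ :+ γ :* d :+ γ :* δ)
             :+ ((b :* β :* γ :* δ :+ d :* α :* β :* δ) :+ (b :* β :* γ :* δ :+ d :* α :* β :* δ))
           := β :* δ :* (a :* δ :+ α :* d :+ b :* γ :+ β :* c) :+ (b :* δ :+ β :* δ :+ β :* d) :* (α :* δ :+ β :* γ))
           refl a b c d α β γ δ ⟩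
    β * δ * (a * δ + α * d + b * γ + β * c) + (b * δ + β * δ + β * d) * (α * δ + β * γ)
      ≡⟨ cong₂ (λ k D → β * δ * k + (b * δ + β * δ + β * d) * D) K≡0 D≡0 ⟩
    β * δ * 0# + (b * δ + β * δ + β * d) * 0#
      ≡⟨ vanish _ _ ⟩
    0# ∎)
    where
    E : Fin q
    E = b * β * γ * δ + d * α * β * δ

  cross-vanishes : ∀ a b α β → α * α ≡ 0# → β * β ≡ 0# → cross a b α β ≡ 0#
  cross-vanishes a b α β αα≡0 ββ≡0 with square-zero α αα≡0 | square-zero β ββ≡0
  ... | refl | refl = begin
    a * 0# + 0# * b + 0# * 0#   ≡⟨ cong₂ (λ x y → x + y + 0# * 0#) (zeroʳ a) (zeroˡ b) ⟩
    0# + 0# + 0# * 0#           ≡⟨ cong₂ _+_ (+-identityʳ 0#) (zeroʳ 0#) ⟩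
    0# + 0#                     ≡⟨ +-identityʳ 0# ⟩
    0#                          ∎

  -- the difference system of two elements of the twisted family is solvable:
  -- by Cramer's rule if det Δ ≠ 0, by compatibility if Δ is singular
  difference-solvable : ∀ m Δ → IsSL m → IsSL (m ⊕ Δ) → ∃ (DifferenceSystem m Δ)
  difference-solvable (a , b , c , d) (α , β , γ , δ) det det′ with α * δ + β * γ ≟ 0#
  ... | no D≢0 = cramer _ _ _ _ _ _ λ eq → D≢0 (begin
    α * δ + β * γ    ≡⟨ cong (_+ β * γ) (square-injective (squares eq)) ⟩
    β * γ + β * γ    ≡⟨ self-inverse (β * γ) ⟩
    0#               ∎)
    where
    -- det of the difference system is (α δ)² - (β γ)²
    squares : α * α * (δ * δ) ≡ β * β * (γ * γ) → α * δ * (α * δ) ≡ β * γ * (β * γ)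
    squares eq = begin
      α * δ * (α * δ)     ≡⟨ solve 2 (λ α δ → α :* δ :* (α :* δ) := α :* α :* (δ :* δ)) refl α δ ⟩
      α * α * (δ * δ)     ≡⟨ eq ⟩
      β * β * (γ * γ)     ≡⟨ solve 2 (λ β γ → β :* β :* (γ :* γ) := β :* γ :* (β :* γ)) refl β γ ⟩
      β * γ * (β * γ)     ∎
  ... | yes D≡0 = singular _ _ _ _ _ _ (compatible₁ a b c d α β γ δ K≡0 D≡0) (compatible₂ a b c d α β γ δ K≡0 D≡0)
                    (cross-vanishes a b α β) (cross-vanishes c d γ δ)
    where
    K : Fin q
    K = a * δ + α * d + b * γ + β * c
    -- det (m ⊕ Δ) = det m + K + det Δ, and both determinants are one
    K≡0 : K ≡ 0#
    K≡0 = +-cancelˡ (a * d + b * c) K 0# (begin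
      a * d + b * c + K
        ≡⟨ sym (+-identityʳ _) ⟩
      a * d + b * c + K + 0#
        ≡⟨ cong (a * d + b * c + K +_) (sym D≡0) ⟩
      a * d + b * c + K + (α * δ + β * γ)
        ≡⟨ solve 8 (λ a b c d α β γ δ →
             a :* d :+ b :* c :+ (a :* δ :+ α :* d :+ b :* γ :+ β :* c) :+ (α :* δ :+ β :* γ)
             := (a :+ α) :* (d :+ δ) :+ (b :+ β) :* (c :+ γ)) refl a b c d α β γ δ ⟩
      (a + α) * (d + δ) + (b + β) * (c + γ)
        ≡⟨ trans (sl-det det′) (sym (sl-det det)) ⟩
      a * d + b * c
        ≡⟨ sym (+-identityʳ _) ⟩
      a * d + b * c + 0# ∎)

  twisted-intersect : ∀ {m m′} → IsSL m → IsSL m′ → Intersect (twisted m) (twisted m′)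
  twisted-intersect {m} {m′} det det′
    with difference-solvable m (m ⊕ m′) det (subst IsSL (sym (⊕-cancel m m′)) det′)
  ... | p , solves =
    p , sym (trans (cong (λ m″ → act p (twisted m″)) (sym (⊕-cancel m m′))) (agreement m (m ⊕ m′) p solves))

  twisted-intersecting : IsIntersecting (map twisted sl2)
  twisted-intersecting =
    AllProperties.map⁺ (All.tabulate (λ m∈sl2 → twisted-sl (∈-sl2⁻ m∈sl2))) ,
    Unique.map⁺ twisted-injective sl2-unique ,
    pairwise
    where
    pairwise : ∀ {g h} → g ∈ map twisted sl2 → h ∈ map twisted sl2 → Intersect g h
    pairwise g∈ h∈ with ∈-map⁻ twisted g∈ | ∈-map⁻ twisted h∈
    ... | _ , m∈sl2 , refl | _ , m′∈sl2 , refl = twisted-intersect (∈-sl2⁻ m∈sl2) (∈-sl2⁻ m′∈sl2)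

  identity : Matrix
  identity = (1# , 0# , 0# , 1#)

  identity-sl : IsSL identity
  identity-sl = begin
    1# * 1# + - (0# * 0#)   ≡⟨ cong₂ _+_ (*-identityʳ 1#) (negation-trivial (0# * 0#)) ⟩
    1# + 0# * 0#            ≡⟨ cong (1# +_) (zeroʳ 0#) ⟩
    1# + 0#                 ≡⟨ +-identityʳ 1# ⟩
    1#                      ∎

  twisted-identity : ∀ i → act i (twisted identity) ≡ i
  twisted-identity (x , y) = cong₂ _,_ (begin
    1# * 1# * x + 0# * 0# * y + 1# * 0#   ≡⟨ cong₂ (λ u v → u * x + v * y + 1# * 0#) (*-identityʳ 1#) (zeroʳ 0#) ⟩
    1# * x + 0# * y + 1# * 0#             ≡⟨ cong₂ (λ u v → u + v + 1# * 0#) (*-identityˡ x) (zeroˡ y) ⟩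
    x + 0# + 1# * 0#                      ≡⟨ cong₂ _+_ (+-identityʳ x) (zeroʳ 1#) ⟩
    x + 0#                                ≡⟨ +-identityʳ x ⟩
    x                                     ∎) (begin
    0# * 0# * x + 1# * 1# * y + 0# * 1#   ≡⟨ cong₂ (λ u v → u * x + v * y + 0# * 1#) (zeroʳ 0#) (*-identityʳ 1#) ⟩
    0# * x + 1# * y + 0# * 1#             ≡⟨ cong₂ (λ u v → u + v + 0# * 1#) (zeroˡ x) (*-identityˡ y) ⟩
    0# + y + 0# * 1#                      ≡⟨ cong₂ _+_ (+-identityˡ y) (zeroˡ 1#) ⟩
    y + 0#                                ≡⟨ +-identityʳ y ⟩
    y                                     ∎)

  transvection : Fin q → Fin q → Affine
  transvection y₀ s = affine 1# (s * s) 0# 1# (s * s * y₀) 0#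

  transvection-sl : ∀ y₀ s → InASL (transvection y₀ s)
  transvection-sl y₀ s = begin
    1# * 1# + - (s * s * 0#)   ≡⟨ cong₂ _+_ (*-identityʳ 1#) (negation-trivial _) ⟩
    1# + s * s * 0#            ≡⟨ cong (1# +_) (zeroʳ (s * s)) ⟩
    1# + 0#                    ≡⟨ +-identityʳ 1# ⟩
    1#                         ∎

  transvection-fixes : ∀ x₀ y₀ s → act (x₀ , y₀) (transvection y₀ s) ≡ (x₀ , y₀)
  transvection-fixes x₀ y₀ s = cong₂ _,_ (begin
    1# * x₀ + s * s * y₀ + s * s * y₀     ≡⟨ +-assoc _ _ _ ⟩
    1# * x₀ + (s * s * y₀ + s * s * y₀)   ≡⟨ drop-double _ _ ⟩
    1# * x₀                               ≡⟨ *-identityˡ x₀ ⟩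
    x₀                                    ∎) (begin
    0# * x₀ + 1# * y₀ + 0#                ≡⟨ +-identityʳ _ ⟩
    0# * x₀ + 1# * y₀                     ≡⟨ cong₂ _+_ (zeroˡ x₀) (*-identityˡ y₀) ⟩
    0# + y₀                               ≡⟨ +-identityˡ y₀ ⟩
    y₀                                    ∎)

  -- a twisted transvection g_m = transvection y₀ s has m = (1 s ; 0 1), so s = s² y₀
  twisted-transvection : ∀ m y₀ s → transvection y₀ s ≡ twisted m → s ≡ s * s * y₀
  twisted-transvection (a , b , c , d) y₀ s eq = begin
    s            ≡⟨ sym (*-identityˡ s) ⟩
    1# * s       ≡⟨ cong₂ _*_ (sym a≡1) (sym b≡s) ⟩
    a * b        ≡⟨ sym (cong Affine.v₁ eq) ⟩
    s * s * y₀   ∎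
    where
    a≡1 : a ≡ 1#
    a≡1 = square-injective (trans (sym (cong Affine.a eq)) (sym (*-identityʳ 1#)))
    b≡s : b ≡ s
    b≡s = square-injective (sym (cong Affine.b eq))

  -- if the twisted family were the canonical set S_{i,j}, then j = i since it contains
  -- the identity, all its transvections fixing i would be twisted, forcing s = s²
  -- for every s, which fails for s = t
  twisted-not-canonical : ∀ t → ¬ t ≡ 0# → ¬ t ≡ 1# → ∀ i j → ¬ IsCanonical i j (map twisted sl2)
  twisted-not-canonical t t≢0 t≢1 (x₀ , y₀) j (_ , members) = t≢1 (sum-zero (no-zero-divisors t[t+1]≡0 t≢0))
    where
    i≡j : (x₀ , y₀) ≡ j
    i≡j = trans (sym (twisted-identity (x₀ , y₀)))
                (proj₂ (proj₁ (members (twisted identity)) (∈-map⁺ twisted (∈-sl2⁺ identity-sl))))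
    -- every transvection fixing i lies in T
    square-law : ∀ s → s ≡ s * s * y₀
    square-law s with ∈-map⁻ twisted (proj₂ (members (transvection y₀ s))
                        (transvection-sl y₀ s , trans (transvection-fixes x₀ y₀ s) i≡j))
    ... | m , _ , eq = twisted-transvection m y₀ s eq
    y₀≡1 : y₀ ≡ 1#
    y₀≡1 = sym (trans (square-law 1#) (trans (cong (_* y₀) (*-identityʳ 1#)) (*-identityˡ y₀)))
    idempotent : t * t ≡ t
    idempotent = sym (trans (square-law t) (trans (cong (t * t *_) y₀≡1) (*-identityʳ (t * t))))
    t[t+1]≡0 : t * (t + 1#) ≡ 0#
    t[t+1]≡0 = begin
      t * (t + 1#)        ≡⟨ distribˡ t t 1# ⟩
      t * t + t * 1#      ≡⟨ cong₂ _+_ idempotent (*-identityʳ t) ⟩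
      t + t               ≡⟨ self-inverse t ⟩
      0#                  ∎

  not-strictEKR : (∃ λ t → ¬ t ≡ 0# × ¬ t ≡ 1#) → ¬ StrictEKR
  not-strictEKR (t , t≢0 , t≢1) =
    strictEKR-fails F origin origin (map linear sl2) (map twisted sl2) stabiliser-canonical twisted-intersecting
      (trans (length-map twisted sl2) (sym (length-map linear sl2))) (twisted-not-canonical t t≢0 t≢1)

third-element : ∀ {n} → 3 ≤ n → (x y : Fin n) → ∃ λ t → ¬ t ≡ x × ¬ t ≡ y
third-element (s≤s (s≤s (s≤s _))) x y with x ≟ y
... | yes refl = punchIn x zero , punchInᵢ≢i x zero , punchInᵢ≢i x zero
... | no x≢y = punchIn x (punchIn y′ zero) , punchInᵢ≢i x _ , t≢y
  where
  -- y = punchIn x y′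
  y′ : Fin _
  y′ = punchOut x≢y
  t≢y : ¬ punchIn x (punchIn y′ zero) ≡ y
  t≢y t≡y = punchInᵢ≢i y′ zero (punchIn-injective x _ _ (trans t≡y (sym (punchIn-punchOut x≢y))))

theorem6p2 : (e : ℕ) → 2 ≤ e → (F : FieldOn (2 ^ e)) → ¬ ASL2.StrictEKR F
theorem6p2 (suc k) 2≤e F = TwistedFamily.not-strictEKR F char2 outside-prime-field
  where
  open FieldFacts F using (0#; 1#; HasCharacteristicTwo; even-order⇒char2)
  char2 : HasCharacteristicTwo
  char2 = even-order⇒char2 (m∣m*n (2 ^ k))
  outside-prime-field : ∃ λ t → ¬ t ≡ 0# × ¬ t ≡ 1#
  outside-prime-field = third-element (≤-trans (s≤s (s≤s (s≤s z≤n))) (^-monoʳ-≤ 2 2≤e)) 0# 1#
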